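{- Let $m,n\ge1$ and $k\ge0$ be integers. For $\mathbf{x}\in(\mathbb{Z}_m)^n$ let $\mathcal{Z}(\mathbf{x})$ be the number of coordinates of $\mathbf{x}$ equal to $0$. Let $A=\mathbf{A}_{\mathrm{Bin}}((\mathbb{Z}_m)^n,\mathcal{Z},k)$ be the $m^n\times m^n$ matrix with rows and columns indexed by $(\mathbb{Z}_m)^n$ and $(\mathbf{f},\mathbf{g})$-entry $\binom{\mathcal{Z}(\mathbf{g}-\mathbf{f})}{k}$. Fix a primitive $m$-th root of unity $\zeta$ and, for $\mathbf{y}\in(\mathbb{Z}_m)^n$, let $\chi^{\mathbf{y}}(\mathbf{x})=\zeta^{\sum_i y_ix_i}$ be the associated irreducible character. For $\mathbf{y}\in(\mathbb{Z}_m)^n$ set $$\lambda_{\mathbf{y}}=m^{n-k}\binom{\mathcal{Z}(\mathbf{y})}{n-k}.$$ Then: (1) each $\lambda_{\mathbf{y}}$ is an eigenvalue of $A$; (2) the eigenvalues of $A$, counted with multiplicity, are exactly the values $\lambda_{\mathbf{y}}$, $\mathbf{y}\in(\mathbb{Z}_m)^n$, each $\mathbf{y}$ contributing multiplicity $1$; (3) each $\lambda_{\mathbf{y}}$ is an integer; (4) $0\le\lambda_{\mathbf{y}}\le m^{n-k}\binom{n}{k}$.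
   Context: Binomial coefficients $\binom{a}{b}$ are $0$ when $b>a$ or $b<0$ (so for $k>n$ all quantities $\lambda_{\mathbf{y}}$ are $0$). -}

module Defs where

open import Data.Nat as ℕ using (ℕ; zero; suc; NonZero; _∸_; _^_; _≤ᵇ_)
open import Data.Nat.DivMod using (_mod_)
open import Data.Nat.Combinatorics using (_C_)
open import Data.Fin using (Fin; toℕ)
open import Data.Fin.Properties as FinP using ()
open import Data.Vec as Vec using (Vec; []; _∷_; zipWith)
open import Data.Vec.Properties using (≡-dec)
open import Data.List as List using (List; []; _∷_; allFin; concatMap; map)
open import Data.Integer as ℤ using (ℤ; +_; _*_; _+_; -_)
open import Data.Product using (_×_; _,_)
open import Data.Bool using (if_then_else_)
open import Relation.Nullary using (yes; no)
open import Relation.Binary.PropositionalEquality using (_≡_)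

subMod : {m : ℕ} .{{_ : NonZero m}} → Fin m → Fin m → Fin m
subMod {m} x y = (toℕ x ℕ.+ (m ∸ toℕ y)) mod m

vsub : {m n : ℕ} .{{_ : NonZero m}} → Vec (Fin m) n → Vec (Fin m) n → Vec (Fin m) n
vsub g f = zipWith subMod g f

zeroCount : {m n : ℕ} → Vec (Fin m) n → ℕ
zeroCount [] = 0
zeroCount (x ∷ xs) with toℕ x
... | zero  = suc (zeroCount xs)
... | suc _ = zeroCount xs

allVecs : (m n : ℕ) → List (Vec (Fin m) n)
allVecs m zero = [] ∷ []
allVecs m (suc n) = concatMap (λ x → map (x ∷_) (allVecs m n)) (allFin m)

Abin : (m n k : ℕ) .{{_ : NonZero m}} → Vec (Fin m) n → Vec (Fin m) n → ℤ
Abin m n k f g = + (zeroCount (vsub g f) C k)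

-- λ_y = m^(n-k) * binom(𝒵(y), n-k), which is 0 when k > n (binomial convention)
lam : (m n k : ℕ) → Vec (Fin m) n → ℤ
lam m n k y = if k ≤ᵇ n then + (m ^ (n ∸ k) ℕ.* (zeroCount y C (n ∸ k))) else + 0

lamBound : (m n k : ℕ) → ℤ
lamBound m n k = if k ≤ᵇ n then + (m ^ (n ∸ k) ℕ.* (n C k)) else + 0

sumL : {I : Set} → List I → (I → ℤ) → ℤ
sumL [] f = + 0
sumL (i ∷ is) f = f i + sumL is f

prodL : {I : Set} → List I → (I → ℤ) → ℤ
prodL [] f = + 1
prodL (i ∷ is) f = f i * prodL is f

picks : {I : Set} → List I → List (ℕ × I × List I)
picks [] = []
picks (x ∷ xs) = (0 , x , xs) ∷ map (λ { (p , y , ys) → (suc p , y , x ∷ ys) }) (picks xs)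

sign : ℕ → ℤ
sign zero = + 1
sign (suc p) = - sign p

-- determinant of the matrix M restricted to rows `rs` and columns `cs`
-- (Laplace expansion along the first row); the determinant of a matrix indexed
-- by a finite set enumerated by a list L is  detL M L L.
detL : {I : Set} → (I → I → ℤ) → List I → List I → ℤ
detL M [] cs = + 1
detL M (r ∷ rs) cs = sumL (picks cs) (λ { (p , c , cs′) → sign p * (M r c * detL M rs cs′) })

charMat : (m n k : ℕ) .{{_ : NonZero m}} → ℤ → Vec (Fin m) n → Vec (Fin m) n → ℤ
charMat m n k t f g with ≡-dec FinP._≟_ f g
... | yes _ = t ℤ.- Abin m n k f g
... | no _  = ℤ.- Abin m n k f g

charPoly : (m n k : ℕ) .{{_ : NonZero m}} → ℤ → ℤ
charPoly m n k t = detL (charMat m n k t) (allVecs m n) (allVecs m n)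

{-# OPTIONS --safe #-}
module Submission where

-- Instead of the complex characters χ^y we use an integral eigenbasis.  Put
-- w₀ = (1,…,1) and w_j = e₀ − e_j (j ≠ 0) in ℤ^(ℤ_m), and v_y = w_{y₁} ⊗ ⋯ ⊗ w_{y_n}.
-- For every F : ℕ → ℤ the vector v_y is an eigenvector of (F(𝒵(g − f)))_{f,g}:
-- summing over the first coordinate of g, only g₁ = f₁ raises the zero count, so
-- the eigenvalue obeys a two-term recursion along y, which for F = binom(·, k) is
-- solved by λ_y thanks to Pascal's rule.  The v_y are a basis over ℚ: with
-- ψ₀ = (1,…,1), ψ_j = (1,…,1) − m e_j and u_y = ψ_{y₁} ⊗ ⋯ ⊗ ψ_{y_n} we have
-- ⟨u_y, v_y′⟩ = m^n δ_{y y′}, so the matrix P whose columns are the v_y has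
-- det P ≠ 0.  Finally (tI − A) P = P diag(t − λ_y); taking determinants
-- (multiplicativity follows from multilinearity and alternation of the Laplace
-- expansion) and cancelling det P gives det(tI − A) = ∏_y (t − λ_y).

open import Defs
open import Data.Nat using (ℕ; NonZero; _≤_)
open import Data.Fin using (Fin)
open import Data.Vec using (Vec)
open import Data.Integer using (ℤ; +_; _*_; _-_)
open import Data.Integer using () renaming (_≤_ to _≤ℤ_)
open import Data.Product using (_×_; ∃)
open import Relation.Binary.PropositionalEquality using (_≡_; _≢_)

open import Data.Nat as ℕ using (zero; suc; _∸_; _^_; _<_; _≤ᵇ_)
import Data.Nat.Properties as ℕP
open import Data.Nat.DivMod using (_%_; n%n≡0; [m+n]%n≡m%n; m<n⇒m%n≡m)
open import Data.Nat.Combinatorics using (_C_; k>n⇒nCk≡0; nCk+nC[k+1]≡[n+1]C[k+1]; nCk≡nC[n∸k])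
open import Data.Fin as Fin using (toℕ)
import Data.Fin.Properties as FinP
open import Data.Vec as Vec using ([]; _∷_)
import Data.Vec.Properties as VecP
open import Data.Integer as ℤ using (_+_; -_)
import Data.Integer.Properties as ℤP
open import Data.Integer.Tactic.RingSolver using (solve-∀)
open import Data.Bool using (true; false)
open import Data.Product using (_,_; ∃₂)
open import Data.Sum using (inj₁; inj₂)
open import Data.List as List using (List; []; _∷_; _++_; map; length; concatMap; allFin; cartesianProductWith)
import Data.List.Properties as ListP
open import Data.List.Relation.Unary.All as All using (All; []; _∷_)
import Data.List.Relation.Unary.All.Properties as AllP
open import Data.List.Relation.Unary.AllPairs using ([]; _∷_)
open import Data.List.Relation.Unary.Any using (here; there)
open import Data.List.Relation.Unary.Unique.Propositional using (Unique)
import Data.List.Relation.Unary.Unique.Propositional.Properties as UniqueP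
open import Data.List.Membership.Propositional using (_∈_)
import Data.List.Membership.Propositional.Properties as MemP
open import Data.Empty using (⊥-elim)
open import Function using (_∘′_)
open import Relation.Nullary using (Dec; yes; no)
open import Relation.Binary.Definitions using (DecidableEquality; Tri; tri<; tri≈; tri>)
open import Relation.Binary.PropositionalEquality using (refl; sym; trans; cong; cong₂; subst; module ≡-Reasoning)
open ≡-Reasoning

-- Finite sums

module _ {A : Set} where

  sumL-cong : (xs : List A) {f g : A → ℤ} → (∀ x → f x ≡ g x) → sumL xs f ≡ sumL xs g
  sumL-cong []       eq = refl
  sumL-cong (x ∷ xs) eq = cong₂ _+_ (eq x) (sumL-cong xs eq)

  sumL-congᴬ : {xs : List A} {f g : A → ℤ} → All (λ x → f x ≡ g x) xs → sumL xs f ≡ sumL xs g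
  sumL-congᴬ []         = refl
  sumL-congᴬ (eq ∷ eqs) = cong₂ _+_ eq (sumL-congᴬ eqs)

  sumL-zero : {xs : List A} {f : A → ℤ} → All (λ x → f x ≡ + 0) xs → sumL xs f ≡ + 0
  sumL-zero []         = refl
  sumL-zero (eq ∷ eqs) = cong₂ _+_ eq (sumL-zero eqs)

  sumL-+ : (xs : List A) (f g : A → ℤ) → sumL xs (λ x → f x + g x) ≡ sumL xs f + sumL xs g
  sumL-+ []       f g = refl
  sumL-+ (x ∷ xs) f g = trans (cong (_+_ (f x + g x)) (sumL-+ xs f g)) (interchange (f x) (g x) (sumL xs f) (sumL xs g))
    where
    interchange : ∀ a b c d → (a + b) + (c + d) ≡ (a + c) + (b + d)
    interchange = solve-∀

  sumL-*ˡ : (xs : List A) (a : ℤ) (f : A → ℤ) → sumL xs (λ x → a * f x) ≡ a * sumL xs f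
  sumL-*ˡ []       a f = sym (ℤP.*-zeroʳ a)
  sumL-*ˡ (x ∷ xs) a f = trans (cong (_+_ (a * f x)) (sumL-*ˡ xs a f)) (sym (ℤP.*-distribˡ-+ a (f x) _))

  sumL-*ʳ : (xs : List A) (a : ℤ) (f : A → ℤ) → sumL xs (λ x → f x * a) ≡ sumL xs f * a
  sumL-*ʳ xs a f = begin
    sumL xs (λ x → f x * a) ≡⟨ sumL-cong xs (λ x → ℤP.*-comm (f x) a) ⟩
    sumL xs (λ x → a * f x) ≡⟨ sumL-*ˡ xs a f ⟩
    a * sumL xs f           ≡⟨ ℤP.*-comm a _ ⟩
    sumL xs f * a           ∎

  sumL-neg : (xs : List A) (f : A → ℤ) → sumL xs (λ x → - f x) ≡ - sumL xs f
  sumL-neg []       f = refl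
  sumL-neg (x ∷ xs) f = trans (cong (_+_ (- f x)) (sumL-neg xs f)) (sym (ℤP.neg-distrib-+ (f x) _))

  sumL-++ : (xs ys : List A) (f : A → ℤ) → sumL (xs ++ ys) f ≡ sumL xs f + sumL ys f
  sumL-++ []       ys f = sym (ℤP.+-identityˡ _)
  sumL-++ (x ∷ xs) ys f = trans (cong (_+_ (f x)) (sumL-++ xs ys f)) (sym (ℤP.+-assoc (f x) _ _))

  sumL-linear : (xs : List A) {f g h : A → ℤ} (a b : ℤ) →
                (∀ x → f x ≡ a * g x + b * h x) → sumL xs f ≡ a * sumL xs g + b * sumL xs h
  sumL-linear xs {f} {g} {h} a b eq = begin
    sumL xs f                                         ≡⟨ sumL-cong xs eq ⟩
    sumL xs (λ x → a * g x + b * h x)                 ≡⟨ sumL-+ xs _ _ ⟩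
    sumL xs (λ x → a * g x) + sumL xs (λ x → b * h x) ≡⟨ cong₂ _+_ (sumL-*ˡ xs a g) (sumL-*ˡ xs b h) ⟩
    a * sumL xs g + b * sumL xs h                     ∎

module _ {A B : Set} where

  sumL-map : (h : A → B) (xs : List A) (f : B → ℤ) → sumL (map h xs) f ≡ sumL xs (λ x → f (h x))
  sumL-map h []       f = refl
  sumL-map h (x ∷ xs) f = cong (_+_ (f (h x))) (sumL-map h xs f)

  sumL-concatMap : (h : A → List B) (xs : List A) (f : B → ℤ) →
                   sumL (concatMap h xs) f ≡ sumL xs (λ x → sumL (h x) f)
  sumL-concatMap h []       f = refl
  sumL-concatMap h (x ∷ xs) f =
    trans (sumL-++ (h x) (concatMap h xs) f) (cong (_+_ (sumL (h x) f)) (sumL-concatMap h xs f))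

  sumL-swap : (xs : List A) (ys : List B) (f : A → B → ℤ) →
              sumL xs (λ x → sumL ys (f x)) ≡ sumL ys (λ y → sumL xs (λ x → f x y))
  sumL-swap []       ys f = sym (sumL-zero (All.universal (λ _ → refl) ys))
  sumL-swap (x ∷ xs) ys f =
    trans (cong (_+_ (sumL ys (f x))) (sumL-swap xs ys f)) (sym (sumL-+ ys (f x) _))

  sumL-linearΣ : (xs : List A) (L : List B) {f : A → ℤ} (a : B → ℤ) (g : B → A → ℤ) →
                 (∀ x → f x ≡ sumL L (λ s → a s * g s x)) →
                 sumL xs f ≡ sumL L (λ s → a s * sumL xs (g s))
  sumL-linearΣ xs L {f} a g eq = begin
    sumL xs f                                        ≡⟨ sumL-cong xs eq ⟩
    sumL xs (λ x → sumL L (λ s → a s * g s x))       ≡⟨ sumL-swap xs L _ ⟩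
    sumL L (λ s → sumL xs (λ x → a s * g s x))       ≡⟨ sumL-cong L (λ s → sumL-*ˡ xs (a s) (g s)) ⟩
    sumL L (λ s → a s * sumL xs (g s))               ∎

module _ {I : Set} (_≟_ : DecidableEquality I) where

  diagonal : (I → ℤ) → I → I → ℤ
  diagonal d a b with a ≟ b
  ... | yes _ = d a
  ... | no _  = + 0

  diagonal-≡ : ∀ d a → diagonal d a a ≡ d a
  diagonal-≡ d a with a ≟ a
  ... | yes _  = refl
  ... | no a≢a = ⊥-elim (a≢a refl)

  diagonal-≢ : ∀ d {a b} → a ≢ b → diagonal d a b ≡ + 0
  diagonal-≢ d {a} {b} a≢b with a ≟ b
  ... | yes a≡b = ⊥-elim (a≢b a≡b)
  ... | no _    = refl

  sumL-diagonalˡ : (d g : I → ℤ) {L : List I} → Unique L → ∀ {r} → r ∈ L →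
                   sumL L (λ s → diagonal d r s * g s) ≡ d r * g r
  sumL-diagonalˡ d g (x∉ ∷ _) (here refl) =
    trans (cong₂ (λ p q → p * g _ + q) (diagonal-≡ d _)
                 (sumL-zero (All.map (λ x≢s → cong (_* g _) (diagonal-≢ d x≢s)) x∉)))
          (ℤP.+-identityʳ _)
  sumL-diagonalˡ d g (x∉ ∷ u) (there r∈) =
    trans (cong₂ (λ p q → p * g _ + q) (diagonal-≢ d (λ r≡x → All.lookup x∉ r∈ (sym r≡x)))
                 (sumL-diagonalˡ d g u r∈))
          (ℤP.+-identityˡ _)

  sumL-diagonalʳ : (d g : I → ℤ) {L : List I} → Unique L → ∀ {r} → r ∈ L →
                   sumL L (λ s → g s * diagonal d s r) ≡ g r * d r
  sumL-diagonalʳ d g {r ∷ _} (r∉ ∷ _) (here refl) =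
    trans (cong₂ (λ p q → g r * p + q) (diagonal-≡ d r)
                 (sumL-zero (All.map (λ {s} r≢s → trans (cong (g s *_) (diagonal-≢ d (r≢s ∘′ sym))) (ℤP.*-zeroʳ (g s))) r∉)))
          (ℤP.+-identityʳ _)
  sumL-diagonalʳ d g {x ∷ _} (x∉ ∷ u) {r} (there r∈) =
    trans (cong₂ (λ p q → g x * p + q) (diagonal-≢ d (λ x≡r → All.lookup x∉ r∈ x≡r))
                 (sumL-diagonalʳ d g u r∈))
          (trans (cong (λ z → z + g r * d r) (ℤP.*-zeroʳ (g x))) (ℤP.+-identityˡ _))

prodL-≢0 : {A : Set} (xs : List A) {f : A → ℤ} → (∀ x → f x ≢ + 0) → prodL xs f ≢ + 0
prodL-≢0 []       _    ()
prodL-≢0 (x ∷ xs) f≢0 eq with ℤP.i*j≡0⇒i≡0∨j≡0 _ eq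
... | inj₁ fx≡0 = f≢0 x fx≡0
... | inj₂ p≡0  = prodL-≢0 xs f≢0 p≡0

*-diagonal : {I : Set} (_≟_ : DecidableEquality I) (c : ℤ) (d : I → ℤ) (a b : I) →
             c * diagonal _≟_ d a b ≡ diagonal _≟_ (λ x → c * d x) a b
*-diagonal _≟_ c d a b with a ≟ b
... | yes _ = refl
... | no _  = ℤP.*-zeroʳ c

module _ {I : Set} where

  shiftPick : I → ℕ × I × List I → ℕ × I × List I
  shiftPick x (p , y , ys) = (suc p , y , x ∷ ys)

  picks-∷ : (x : I) (xs : List I) → picks (x ∷ xs) ≡ (0 , x , xs) ∷ map (shiftPick x) (picks xs)
  picks-∷ x xs = cong ((0 , x , xs) ∷_) (ListP.map-cong (λ _ → refl) (picks xs))

  laplaceTerm : (List I → ℤ) → (I → ℤ) → ℕ × I × List I → ℤ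
  laplaceTerm minor u (p , c , rest) = sign p * (u c * minor rest)

  IsPick : List I → ℕ × I × List I → Set
  IsPick L (p , s , rest) = ∃₂ λ a b → L ≡ a ++ s ∷ b × rest ≡ a ++ b × p ≡ length a

  picks-sound : (L : List I) → All (IsPick L) (picks L)
  picks-sound []       = []
  picks-sound (x ∷ xs) = subst (All (IsPick (x ∷ xs))) (sym (picks-∷ x xs))
    (([] , xs , refl , refl , refl) ∷ AllP.map⁺ (All.map extend (picks-sound xs)))
    where
    extend : ∀ {p s rest} → IsPick xs (p , s , rest) → IsPick (x ∷ xs) (suc p , s , x ∷ rest)
    extend (a , b , refl , refl , refl) = x ∷ a , b , refl , refl , refl

  sumL-picks : (L : List I) (f : I → ℤ) → sumL L f ≡ sumL (picks L) (λ (_ , s , _) → f s)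
  sumL-picks []       f = refl
  sumL-picks (x ∷ xs) f = begin
    f x + sumL xs f                                                   ≡⟨ cong (_+_ (f x)) (sumL-picks xs f) ⟩
    f x + sumL (picks xs) (λ (_ , s , _) → f s)                       ≡⟨ cong (_+_ (f x)) (sym (sumL-map _ (picks xs) _)) ⟩
    f x + sumL (map (shiftPick x) (picks xs)) (λ (_ , s , _) → f s)
      ≡⟨ cong (λ l → sumL l (λ (_ , s , _) → f s)) (sym (picks-∷ x xs)) ⟩
    sumL (picks (x ∷ xs)) (λ (_ , s , _) → f s)                       ∎

  length-middle : (a b : List I) (s : I) → length (a ++ s ∷ b) ≡ suc (length (a ++ b))
  length-middle []      b s = refl
  length-middle (x ∷ a) b s = cong suc (length-middle a b s)

  sumL-middle : (a b : List I) (s : I) (f : I → ℤ) → sumL (a ++ s ∷ b) f ≡ f s + sumL (a ++ b) f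
  sumL-middle []      b s f = refl
  sumL-middle (x ∷ a) b s f = trans (cong (_+_ (f x)) (sumL-middle a b s f)) (swap (f x) (f s) _)
    where
    swap : ∀ p q r → p + (q + r) ≡ q + (p + r)
    swap = solve-∀

-- Determinants

module Determinant {I : Set} where

  Row : Set
  Row = I → ℤ

  laplace : (List I → ℤ) → Row → List I → ℤ
  laplace minor u cs = sumL (picks cs) (laplaceTerm minor u)

  -- det R cs is the determinant of the rows R restricted to the columns cs, in that order.
  det : List Row → List I → ℤ
  det []      cs = + 1
  det (u ∷ R) cs = laplace (det R) u cs

  laplace-∷ : (h : List I → ℤ) (u : Row) (x : I) (xs : List I) →
              laplace h u (x ∷ xs) ≡ u x * h xs - laplace (λ cs → h (x ∷ cs)) u xs
  laplace-∷ h u x xs = begin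
    laplace h u (x ∷ xs)
      ≡⟨ cong (λ l → sumL l (laplaceTerm h u)) (picks-∷ x xs) ⟩
    + 1 * (u x * h xs) + sumL (map (shiftPick x) (picks xs)) (laplaceTerm h u)
      ≡⟨ cong₂ _+_ (ℤP.*-identityˡ (u x * h xs)) (sumL-map (shiftPick x) (picks xs) (laplaceTerm h u)) ⟩
    u x * h xs + sumL (picks xs) (λ (p , c , rest) → - sign p * (u c * h (x ∷ rest)))
      ≡⟨ cong (_+_ (u x * h xs)) (sumL-cong (picks xs) (λ (p , _ , _) → sym (ℤP.neg-distribˡ-* (sign p) _))) ⟩
    u x * h xs + sumL (picks xs) (λ t → - laplaceTerm h′ u t)
      ≡⟨ cong (_+_ (u x * h xs)) (sumL-neg (picks xs) _) ⟩
    u x * h xs - laplace h′ u xs ∎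
    where
    h′ : List I → ℤ
    h′ cs = h (x ∷ cs)

  laplace-cong : {h h′ : List I → ℤ} {u u′ : Row} → (∀ cs → h cs ≡ h′ cs) → (∀ c → u c ≡ u′ c) →
                 ∀ cs → laplace h u cs ≡ laplace h′ u′ cs
  laplace-cong eqʰ eqᵘ cs = sumL-cong (picks cs) (λ (p , c , rest) → cong₂ (λ a b → sign p * (a * b)) (eqᵘ c) (eqʰ rest))

  laplace-minor-linear : {h h₁ h₂ : List I → ℤ} (a b : ℤ) (u : Row) →
                         (∀ cs → h cs ≡ a * h₁ cs + b * h₂ cs) →
                         ∀ cs → laplace h u cs ≡ a * laplace h₁ u cs + b * laplace h₂ u cs
  laplace-minor-linear {h} {h₁} {h₂} a b u eq cs = sumL-linear (picks cs) a b
    (λ (p , c , rest) → trans (cong (λ z → sign p * (u c * z)) (eq rest)) (distrib (sign p) (u c) a b _ _))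
    where
    distrib : ∀ s v a b x y → s * (v * (a * x + b * y)) ≡ a * (s * (v * x)) + b * (s * (v * y))
    distrib = solve-∀

  laplace-row-linear : (h : List I → ℤ) {u u₁ u₂ : Row} (a b : ℤ) →
                       (∀ c → u c ≡ a * u₁ c + b * u₂ c) →
                       ∀ cs → laplace h u cs ≡ a * laplace h u₁ cs + b * laplace h u₂ cs
  laplace-row-linear h {u} {u₁} {u₂} a b eq cs = sumL-linear (picks cs) a b
    (λ (p , c , rest) → trans (cong (λ z → sign p * (z * h rest)) (eq c)) (distrib (sign p) (h rest) a b _ _))
    where
    distrib : ∀ s v a b x y → s * ((a * x + b * y) * v) ≡ a * (s * (x * v)) + b * (s * (y * v))
    distrib = solve-∀

  module _ {S : Set} (L : List S) (a : S → ℤ) where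

    private
      *-sumL : (c : ℤ) (g : S → ℤ) → c * sumL L (λ s → a s * g s) ≡ sumL L (λ s → a s * (c * g s))
      *-sumL c g = trans (sym (sumL-*ˡ L c _)) (sumL-cong L (λ s → commute c (a s) (g s)))
        where
        commute : ∀ c a g → c * (a * g) ≡ a * (c * g)
        commute = solve-∀

    laplace-minor-Σ : {h : List I → ℤ} (hs : S → List I → ℤ) (u : Row) →
                      (∀ cs → h cs ≡ sumL L (λ s → a s * hs s cs)) →
                      ∀ cs → laplace h u cs ≡ sumL L (λ s → a s * laplace (hs s) u cs)
    laplace-minor-Σ hs u eq cs = sumL-linearΣ (picks cs) L a _
      (λ (p , c , rest) → trans (cong (λ z → sign p * (u c * z)) (eq rest))
                                (trans (cong (sign p *_) (*-sumL (u c) _)) (*-sumL (sign p) _)))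

    laplace-row-Σ : (h : List I → ℤ) {u : Row} (us : S → Row) →
                    (∀ c → u c ≡ sumL L (λ s → a s * us s c)) →
                    ∀ cs → laplace h u cs ≡ sumL L (λ s → a s * laplace h (us s) cs)
    laplace-row-Σ h us eq cs = sumL-linearΣ (picks cs) L a _
      (λ (p , c , rest) → trans (cong (λ z → sign p * (z * h rest)) (eq c))
                                (trans (cong (sign p *_) (trans (ℤP.*-comm _ (h rest)) (*-sumL (h rest) _)))
                                       (trans (*-sumL (sign p) _)
                                              (sumL-cong L (λ s → cong (λ z → a s * (sign p * z)) (ℤP.*-comm (h rest) _))))))

  laplace-zero-row : (h : List I → ℤ) {u : Row} {cs : List I} → All (λ c → u c ≡ + 0) cs → laplace h u cs ≡ + 0
  laplace-zero-row h {u} {[]}     []           = refl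
  laplace-zero-row h {u} {x ∷ xs} (ux≡0 ∷ eqs) = trans (laplace-∷ h u x xs)
    (cong₂ (λ p q → p * h xs - q) ux≡0 (laplace-zero-row _ eqs))

  laplace-laplace-∷ : (h : List I → ℤ) (u w : Row) (x : I) (xs : List I) →
    laplace (laplace h w) u (x ∷ xs)
      ≡ u x * laplace h w xs - w x * laplace h u xs + laplace (laplace (λ cs → h (x ∷ cs)) w) u xs
  laplace-laplace-∷ h u w x xs = begin
    laplace (laplace h w) u (x ∷ xs)
      ≡⟨ laplace-∷ (laplace h w) u x xs ⟩
    u x * laplace h w xs - laplace (λ cs → laplace h w (x ∷ cs)) u xs
      ≡⟨ cong (λ z → u x * laplace h w xs - z)
              (laplace-minor-linear (w x) (- + 1) u
                 (λ cs → trans (laplace-∷ h w x cs) (cong (_+_ (w x * h cs)) (sym (ℤP.-1*i≡-i _)))) xs) ⟩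
    u x * laplace h w xs - (w x * laplace h u xs + - + 1 * laplace (laplace h′ w) u xs)
      ≡⟨ rearrange (u x * laplace h w xs) (w x * laplace h u xs) (laplace (laplace h′ w) u xs) ⟩
    u x * laplace h w xs - w x * laplace h u xs + laplace (laplace h′ w) u xs ∎
    where
    h′ : List I → ℤ
    h′ cs = h (x ∷ cs)
    rearrange : ∀ p q r → p - (q + - + 1 * r) ≡ p - q + r
    rearrange = solve-∀

  laplace-anti : (h : List I → ℤ) (u w : Row) → ∀ cs → laplace (laplace h w) u cs ≡ - laplace (laplace h u) w cs
  laplace-anti h u w []       = refl
  laplace-anti h u w (x ∷ xs) = begin
    laplace (laplace h w) u (x ∷ xs)
      ≡⟨ laplace-laplace-∷ h u w x xs ⟩
    u x * laplace h w xs - w x * laplace h u xs + laplace (laplace h′ w) u xs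
      ≡⟨ cong (_+_ (u x * laplace h w xs - w x * laplace h u xs)) (laplace-anti h′ u w xs) ⟩
    u x * laplace h w xs - w x * laplace h u xs + - laplace (laplace h′ u) w xs
      ≡⟨ rearrange (u x * laplace h w xs) (w x * laplace h u xs) (laplace (laplace h′ u) w xs) ⟩
    - (w x * laplace h u xs - u x * laplace h w xs + laplace (laplace h′ u) w xs)
      ≡⟨ cong -_ (sym (laplace-laplace-∷ h w u x xs)) ⟩
    - laplace (laplace h u) w (x ∷ xs) ∎
    where
    h′ : List I → ℤ
    h′ cs = h (x ∷ cs)
    rearrange : ∀ p q r → p - q + - r ≡ - (q - p + r)
    rearrange = solve-∀

  det-++-linear : {A B₁ B₂ : List Row} (a b : ℤ) → (∀ cs → det A cs ≡ a * det B₁ cs + b * det B₂ cs) →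
                  ∀ pre cs → det (pre ++ A) cs ≡ a * det (pre ++ B₁) cs + b * det (pre ++ B₂) cs
  det-++-linear a b eq []        = eq
  det-++-linear a b eq (u ∷ pre) = laplace-minor-linear a b u (det-++-linear a b eq pre)

  det-++-Σ : {S : Set} (L : List S) (a : S → ℤ) {A : List Row} (B : S → List Row) →
             (∀ cs → det A cs ≡ sumL L (λ s → a s * det (B s) cs)) →
             ∀ pre cs → det (pre ++ A) cs ≡ sumL L (λ s → a s * det (pre ++ B s) cs)
  det-++-Σ L a B eq []        = eq
  det-++-Σ L a B eq (u ∷ pre) = laplace-minor-Σ L a (λ s → det (pre ++ B s)) u (det-++-Σ L a B eq pre)

  det-swap : ∀ pre u w R cs → det (pre ++ u ∷ w ∷ R) cs ≡ - det (pre ++ w ∷ u ∷ R) cs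
  det-swap pre u w R cs =
    trans (det-++-linear {B₂ = w ∷ u ∷ R} (- + 1) (+ 0) (λ cs → trans (laplace-anti (det R) u w cs) (as-combination _)) pre cs)
          (sym (as-combination (det (pre ++ w ∷ u ∷ R) cs)))
    where
    as-combination : ∀ x → - x ≡ - + 1 * x + + 0 * x
    as-combination = solve-∀

  private
    self≡neg⇒0 : ∀ x → x ≡ - x → x ≡ + 0
    self≡neg⇒0 (+ zero)   _  = refl
    self≡neg⇒0 (+ suc n)  ()
    self≡neg⇒0 ℤ.-[1+ n ] ()

  det-equal-rows : ∀ pre u mid post cs → det (pre ++ u ∷ mid ++ u ∷ post) cs ≡ + 0
  det-equal-rows pre u []        post cs = self≡neg⇒0 _ (det-swap pre u u post cs)
  det-equal-rows pre u (v ∷ mid) post cs = begin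
    det (pre ++ u ∷ v ∷ mid ++ u ∷ post) cs      ≡⟨ det-swap pre u v _ cs ⟩
    - det (pre ++ v ∷ u ∷ mid ++ u ∷ post) cs    ≡⟨ cong (λ l → - det l cs) (sym (ListP.++-assoc pre (v ∷ []) _)) ⟩
    - det ((pre ++ v ∷ []) ++ u ∷ mid ++ u ∷ post) cs ≡⟨ cong -_ (det-equal-rows (pre ++ v ∷ []) u mid post cs) ⟩
    + 0                                          ∎

  det-row-linear : ∀ pre {u u₁ u₂} (a b : ℤ) R → (∀ c → u c ≡ a * u₁ c + b * u₂ c) →
                   ∀ cs → det (pre ++ u ∷ R) cs ≡ a * det (pre ++ u₁ ∷ R) cs + b * det (pre ++ u₂ ∷ R) cs
  det-row-linear pre a b R eq = det-++-linear a b (laplace-row-linear (det R) a b eq) pre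

  det-row-Σ : {S : Set} (L : List S) (a : S → ℤ) (us : S → Row) → ∀ pre {u} R →
              (∀ c → u c ≡ sumL L (λ s → a s * us s c)) →
              ∀ cs → det (pre ++ u ∷ R) cs ≡ sumL L (λ s → a s * det (pre ++ us s ∷ R) cs)
  det-row-Σ L a us pre R eq = det-++-Σ L a (λ s → us s ∷ R) (laplace-row-Σ L a (det R) us eq) pre

  det-++-cong : {A B : List Row} → (∀ cs → det A cs ≡ det B cs) → ∀ pre cs → det (pre ++ A) cs ≡ det (pre ++ B) cs
  det-++-cong eq []        = eq
  det-++-cong eq (u ∷ pre) = laplace-cong {u = u} (det-++-cong eq pre) (λ _ → refl)

  det-map-cong : {J : Set} {F G : J → Row} → (∀ r c → F r c ≡ G r c) → ∀ R cs → det (map F R) cs ≡ det (map G R) cs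
  det-map-cong eq []      cs = refl
  det-map-cong eq (r ∷ R) cs = laplace-cong (det-map-cong eq R) (eq r) cs

  det-move : {K : Set} (X : K → Row) (a b : List K) (s : K) →
             ∀ pre cs → det (pre ++ X s ∷ map X (a ++ b)) cs ≡ sign (length a) * det (pre ++ map X (a ++ s ∷ b)) cs
  det-move X []      b s pre cs = sym (ℤP.*-identityˡ _)
  det-move X (x ∷ a) b s pre cs = begin
    det (pre ++ X s ∷ X x ∷ map X (a ++ b)) cs
      ≡⟨ det-swap pre (X s) (X x) _ cs ⟩
    - det (pre ++ X x ∷ X s ∷ map X (a ++ b)) cs
      ≡⟨ cong (λ l → - det l cs) (sym (ListP.++-assoc pre (X x ∷ []) _)) ⟩
    - det ((pre ++ X x ∷ []) ++ X s ∷ map X (a ++ b)) cs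
      ≡⟨ cong -_ (det-move X a b s (pre ++ X x ∷ []) cs) ⟩
    - (sign (length a) * det ((pre ++ X x ∷ []) ++ map X (a ++ s ∷ b)) cs)
      ≡⟨ cong (λ l → - (sign (length a) * det l cs)) (ListP.++-assoc pre (X x ∷ []) _) ⟩
    - (sign (length a) * det (pre ++ X x ∷ map X (a ++ s ∷ b)) cs)
      ≡⟨ ℤP.neg-distribˡ-* (sign (length a)) _ ⟩
    - sign (length a) * det (pre ++ X x ∷ map X (a ++ s ∷ b)) cs ∎

  det-add-multiples : {J : Set} (Z : J → Row) (e : J → ℤ) (w : Row) →
    ∀ pre mid R cs → det (pre ++ w ∷ mid ++ map (λ r c → Z r c + e r * w c) R) cs ≡ det (pre ++ w ∷ mid ++ map Z R) cs
  det-add-multiples Z e w pre mid []      cs = refl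
  det-add-multiples Z e w pre mid (r ∷ R) cs = begin
    det (pre ++ w ∷ mid ++ Zw r ∷ map Zw R) cs
      ≡⟨ cong (λ l → det l cs) (sym (ListP.++-assoc pre (w ∷ mid) _)) ⟩
    det ((pre ++ w ∷ mid) ++ Zw r ∷ map Zw R) cs
      ≡⟨ det-row-linear (pre ++ w ∷ mid) (+ 1) (e r) _ (λ c → cong (_+ e r * w c) (sym (ℤP.*-identityˡ (Z r c)))) cs ⟩
    + 1 * det ((pre ++ w ∷ mid) ++ Z r ∷ map Zw R) cs + e r * det ((pre ++ w ∷ mid) ++ w ∷ map Zw R) cs
      ≡⟨ cong₂ (λ p q → + 1 * det p cs + e r * det q cs) (ListP.++-assoc pre (w ∷ mid) _) (ListP.++-assoc pre (w ∷ mid) _) ⟩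
    + 1 * det (pre ++ w ∷ mid ++ Z r ∷ map Zw R) cs + e r * det (pre ++ w ∷ mid ++ w ∷ map Zw R) cs
      ≡⟨ cong (λ q → + 1 * det (pre ++ w ∷ mid ++ Z r ∷ map Zw R) cs + e r * q) (det-equal-rows pre w mid _ cs) ⟩
    + 1 * det (pre ++ w ∷ mid ++ Z r ∷ map Zw R) cs + e r * + 0
      ≡⟨ drop-zero _ (e r) ⟩
    det (pre ++ w ∷ mid ++ Z r ∷ map Zw R) cs
      ≡⟨ cong (λ l → det (pre ++ w ∷ l) cs) (sym (ListP.++-assoc mid (Z r ∷ []) _)) ⟩
    det (pre ++ w ∷ (mid ++ Z r ∷ []) ++ map Zw R) cs
      ≡⟨ det-add-multiples Z e w pre (mid ++ Z r ∷ []) R cs ⟩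
    det (pre ++ w ∷ (mid ++ Z r ∷ []) ++ map Z R) cs
      ≡⟨ cong (λ l → det (pre ++ w ∷ l) cs) (ListP.++-assoc mid (Z r ∷ []) _) ⟩
    det (pre ++ w ∷ mid ++ Z r ∷ map Z R) cs ∎
    where
    Zw : _ → Row
    Zw r c = Z r c + e r * w c
    drop-zero : ∀ x y → + 1 * x + y * + 0 ≡ x
    drop-zero = solve-∀

  module _ {K : Set} (M : K → K → ℤ) (X : K → Row) where

    matMul : List K → K → Row
    matMul L r c = sumL L (λ s → M r s * X s c)

    det-eliminate : ∀ a b s rs pre cs →
      det (pre ++ X s ∷ map (matMul (a ++ s ∷ b)) rs) cs ≡ det ((pre ++ X s ∷ []) ++ map (matMul (a ++ b)) rs) cs
    det-eliminate a b s rs pre cs = begin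
      det (pre ++ X s ∷ map (matMul (a ++ s ∷ b)) rs) cs
        ≡⟨ det-++-cong (laplace-cong {u = X s} (det-map-cong pivot-split rs) (λ _ → refl)) pre cs ⟩
      det (pre ++ X s ∷ [] ++ map (λ r c → matMul (a ++ b) r c + M r s * X s c) rs) cs
        ≡⟨ det-add-multiples (matMul (a ++ b)) (λ r → M r s) (X s) pre [] rs cs ⟩
      det (pre ++ X s ∷ map (matMul (a ++ b)) rs) cs
        ≡⟨ cong (λ l → det l cs) (sym (ListP.++-assoc pre (X s ∷ []) _)) ⟩
      det ((pre ++ X s ∷ []) ++ map (matMul (a ++ b)) rs) cs ∎
      where
      pivot-split : ∀ r c → matMul (a ++ s ∷ b) r c ≡ matMul (a ++ b) r c + M r s * X s c
      pivot-split r c = trans (sumL-middle a b s (λ s → M r s * X s c)) (ℤP.+-comm (M r s * X s c) _)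

    -- Expanding the first row of M·X as Σ_s M r s · X s and clearing X s from the
    -- remaining rows reduces to the same statement with X s appended to pre.
    det-mul-++ : ∀ rs L → length rs ≡ length L →
                 ∀ pre cs → det (pre ++ map (matMul L) rs) cs ≡ detL M rs L * det (pre ++ map X L) cs
    det-mul-++ []       []      _  pre cs = sym (ℤP.*-identityˡ _)
    det-mul-++ (r ∷ rs) L       eq pre cs = begin
      det (pre ++ matMul L r ∷ map (matMul L) rs) cs
        ≡⟨ det-row-Σ L (M r) X pre _ (λ _ → refl) cs ⟩
      sumL L (λ s → M r s * det (pre ++ X s ∷ map (matMul L) rs) cs)
        ≡⟨ sumL-picks L _ ⟩
      sumL (picks L) (λ (_ , s , _) → M r s * det (pre ++ X s ∷ map (matMul L) rs) cs)
        ≡⟨ sumL-congᴬ (All.map pick-summand (picks-sound L)) ⟩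
      sumL (picks L) (λ t → laplaceTerm (detL M rs) (M r) t * D)
        ≡⟨ sumL-*ʳ (picks L) D _ ⟩
      detL M (r ∷ rs) L * D ∎
      where
      D : ℤ
      D = det (pre ++ map X L) cs
      pick-summand : ∀ {p s rest} → IsPick L (p , s , rest) →
                     M r s * det (pre ++ X s ∷ map (matMul L) rs) cs ≡ laplaceTerm (detL M rs) (M r) (p , s , rest) * D
      pick-summand {s = s} (a , b , refl , refl , refl) = begin
        M r s * det (pre ++ X s ∷ map (matMul (a ++ s ∷ b)) rs) cs
          ≡⟨ cong (M r s *_) (det-eliminate a b s rs pre cs) ⟩
        M r s * det ((pre ++ X s ∷ []) ++ map (matMul (a ++ b)) rs) cs
          ≡⟨ cong (M r s *_) (det-mul-++ rs (a ++ b) (ℕP.suc-injective (trans eq (length-middle a b s))) (pre ++ X s ∷ []) cs) ⟩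
        M r s * (detL M rs (a ++ b) * det ((pre ++ X s ∷ []) ++ map X (a ++ b)) cs)
          ≡⟨ cong (λ l → M r s * (detL M rs (a ++ b) * det l cs)) (ListP.++-assoc pre (X s ∷ []) _) ⟩
        M r s * (detL M rs (a ++ b) * det (pre ++ X s ∷ map X (a ++ b)) cs)
          ≡⟨ cong (λ z → M r s * (detL M rs (a ++ b) * z)) (det-move X a b s pre cs) ⟩
        M r s * (detL M rs (a ++ b) * (sign (length a) * D))
          ≡⟨ rearrange (M r s) (detL M rs (a ++ b)) (sign (length a)) D ⟩
        sign (length a) * (M r s * detL M rs (a ++ b)) * D ∎
        where
        rearrange : ∀ m d σ x → m * (d * (σ * x)) ≡ σ * (m * d) * x
        rearrange = solve-∀

    det-mul : (L : List K) (cs : List I) → det (map (matMul L) L) cs ≡ detL M L L * det (map X L) cs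
    det-mul L = det-mul-++ L L refl []

  detL≡det : (M : I → I → ℤ) → ∀ rs cs → detL M rs cs ≡ det (map M rs) cs
  detL≡det M []       cs = refl
  detL≡det M (r ∷ rs) cs = laplace-cong {u = M r} (detL≡det M rs) (λ _ → refl) cs

  det-diagonal : (_≟_ : DecidableEquality I) (d : I → ℤ) → ∀ L → Unique L → det (map (diagonal _≟_ d) L) L ≡ prodL L d
  det-diagonal _≟_ d []       _         = refl
  det-diagonal _≟_ d (x ∷ xs) (x∉ ∷ u) = begin
    laplace (det (map D xs)) (D x) (x ∷ xs)
      ≡⟨ laplace-∷ _ (D x) x xs ⟩
    D x x * det (map D xs) xs - laplace _ (D x) xs
      ≡⟨ cong₂ (λ p q → p * det (map D xs) xs - q) (diagonal-≡ _≟_ d x) (laplace-zero-row _ (All.map (diagonal-≢ _≟_ d) x∉)) ⟩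
    d x * det (map D xs) xs + - + 0
      ≡⟨ ℤP.+-identityʳ _ ⟩
    d x * det (map D xs) xs
      ≡⟨ cong (d x *_) (det-diagonal _≟_ d xs u) ⟩
    d x * prodL xs d ∎
    where
    D : I → I → ℤ
    D = diagonal _≟_ d

open Determinant

-- Vectors over ℤ_m

module _ (m : ℕ) where

  allVecs-suc : ∀ n → allVecs m (suc n) ≡ cartesianProductWith _∷_ (allFin m) (allVecs m n)
  allVecs-suc n = go (allFin m)
    where
    go : ∀ xs → concatMap (λ x → map (x ∷_) (allVecs m n)) xs ≡ cartesianProductWith _∷_ xs (allVecs m n)
    go []       = refl
    go (x ∷ xs) = cong (map (x ∷_) (allVecs m n) ++_) (go xs)

  ∈-allVecs : ∀ {n} (v : Vec (Fin m) n) → v ∈ allVecs m n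
  ∈-allVecs []      = here refl
  ∈-allVecs (x ∷ v) = subst (_ ∈_) (sym (allVecs-suc _))
    (MemP.∈-cartesianProductWith⁺ _∷_ (MemP.∈-allFin x) (∈-allVecs v))

  allVecs-unique : ∀ n → Unique (allVecs m n)
  allVecs-unique zero    = [] ∷ []
  allVecs-unique (suc n) = subst Unique (sym (allVecs-suc n))
    (UniqueP.cartesianProductWith⁺ _∷_ VecP.∷-injective (UniqueP.allFin⁺ m) (allVecs-unique n))

  sumL-allVecs-suc : ∀ n (f : Vec (Fin m) (suc n) → ℤ) →
                     sumL (allVecs m (suc n)) f ≡ sumL (allFin m) (λ x → sumL (allVecs m n) (λ v → f (x ∷ v)))
  sumL-allVecs-suc n f =
    trans (sumL-concatMap _ (allFin m) f) (sumL-cong (allFin m) (λ x → sumL-map (x ∷_) (allVecs m n) f))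

zeroCount-∷-zero : ∀ {m n} (x : Fin m) (r : Vec (Fin m) n) → toℕ x ≡ 0 → zeroCount (x ∷ r) ≡ suc (zeroCount r)
zeroCount-∷-zero x r x≡0 with toℕ x
zeroCount-∷-zero x r refl | .0 = refl

zeroCount-∷-nonzero : ∀ {m n} (x : Fin m) (r : Vec (Fin m) n) → toℕ x ≢ 0 → zeroCount (x ∷ r) ≡ zeroCount r
zeroCount-∷-nonzero x r x≢0 with toℕ x
... | zero  = ⊥-elim (x≢0 refl)
... | suc _ = refl

zeroCount≤length : ∀ {m n} (y : Vec (Fin m) n) → zeroCount y ℕ.≤ n
zeroCount≤length []           = ℕ.z≤n
zeroCount≤length (Fin.zero  ∷ y) = ℕ.s≤s (zeroCount≤length y)
zeroCount≤length (Fin.suc _ ∷ y) = ℕP.m≤n⇒m≤1+n (zeroCount≤length y)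

module _ {m : ℕ} .{{_ : ℕ.NonZero m}} where

  toℕ-subMod : (x y : Fin m) → toℕ (subMod x y) ≡ (toℕ x ℕ.+ (m ∸ toℕ y)) % m
  toℕ-subMod x y = FinP.toℕ-fromℕ< _

  subMod-self : (x : Fin m) → toℕ (subMod x x) ≡ 0
  subMod-self x = begin
    toℕ (subMod x x)                  ≡⟨ toℕ-subMod x x ⟩
    (toℕ x ℕ.+ (m ∸ toℕ x)) % m       ≡⟨ cong (_% m) (ℕP.m+[n∸m]≡n (ℕP.<⇒≤ (FinP.toℕ<n x))) ⟩
    m % m                             ≡⟨ n%n≡0 m ⟩
    0                                 ∎

  subMod≡0⇒≡ : (x y : Fin m) → toℕ (subMod x y) ≡ 0 → x ≡ y
  subMod≡0⇒≡ x y eq = FinP.toℕ-injective (go (ℕP.<-cmp a b))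
    where
    a b : ℕ
    a = toℕ x
    b = toℕ y
    a<m : a < m
    a<m = FinP.toℕ<n x
    b<m : b < m
    b<m = FinP.toℕ<n y
    eq′ : (a ℕ.+ (m ∸ b)) % m ≡ 0
    eq′ = trans (sym (toℕ-subMod x y)) eq
    go : Tri (a < b) (a ≡ b) (b < a) → a ≡ b
    go (tri≈ _ a≡b _) = a≡b
    go (tri< a<b _ _) = ⊥-elim (ℕP.m>n⇒m∸n≢0 b<m (ℕP.m+n≡0⇒n≡0 a (trans (sym (m<n⇒m%n≡m no-wrap)) eq′)))
      where
      no-wrap : a ℕ.+ (m ∸ b) < m
      no-wrap = ℕP.≤-trans (ℕP.+-monoˡ-≤ (m ∸ b) a<b) (ℕP.≤-reflexive (ℕP.m+[n∸m]≡n (ℕP.<⇒≤ b<m)))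
    go (tri> _ _ b<a) = ⊥-elim (ℕP.m>n⇒m∸n≢0 b<a (begin
      a ∸ b                   ≡⟨ sym (m<n⇒m%n≡m (ℕP.≤-<-trans (ℕP.m∸n≤m a b) a<m)) ⟩
      (a ∸ b) % m             ≡⟨ sym ([m+n]%n≡m%n (a ∸ b) m) ⟩
      ((a ∸ b) ℕ.+ m) % m     ≡⟨ cong (_% m) (sym (ℕP.+-∸-comm m (ℕP.<⇒≤ b<a))) ⟩
      ((a ℕ.+ m) ∸ b) % m     ≡⟨ cong (_% m) (ℕP.+-∸-assoc a (ℕP.<⇒≤ b<m)) ⟩
      (a ℕ.+ (m ∸ b)) % m     ≡⟨ eq′ ⟩
      0                       ∎))

module _ {m n k : ℕ} where

  lam-≤ : (y : Vec (Fin m) n) → k ℕ.≤ n → lam m n k y ≡ + (m ^ (n ∸ k) ℕ.* (zeroCount y C (n ∸ k)))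
  lam-≤ y k≤n with k ≤ᵇ n | ℕP.≤⇒≤ᵇ k≤n
  ... | true | _ = refl

  lam-> : (y : Vec (Fin m) n) → n < k → lam m n k y ≡ + 0
  lam-> y n<k with k ≤ᵇ n | ℕP.≤ᵇ⇒≤ k n
  ... | true  | k≤n = ⊥-elim (ℕP.<⇒≱ n<k (k≤n _))
  ... | false | _   = refl

  lamBound-≤ : k ℕ.≤ n → lamBound m n k ≡ + (m ^ (n ∸ k) ℕ.* (n C k))
  lamBound-≤ k≤n with k ≤ᵇ n | ℕP.≤⇒≤ᵇ k≤n
  ... | true | _ = refl

  lamBound-> : n < k → lamBound m n k ≡ + 0
  lamBound-> n<k with k ≤ᵇ n | ℕP.≤ᵇ⇒≤ k n
  ... | true  | k≤n = ⊥-elim (ℕP.<⇒≱ n<k (k≤n _))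
  ... | false | _   = refl

C-monoˡ-≤ : ∀ j {a b} → a ℕ.≤ b → a C j ℕ.≤ b C j
C-monoˡ-≤ j a≤b = go (ℕP.≤⇒≤′ a≤b)
  where
  C-suc : ∀ a j → a C j ℕ.≤ suc a C j
  C-suc a zero    = ℕP.≤-refl
  C-suc a (suc j) = ℕP.≤-trans (ℕP.m≤n+m (a C suc j) (a C j)) (ℕP.≤-reflexive (nCk+nC[k+1]≡[n+1]C[k+1] a j))
  go : ∀ {a b} → a ℕ.≤′ b → a C j ℕ.≤ b C j
  go ℕ.≤′-refl      = ℕP.≤-refl
  go (ℕ.≤′-step a≤b) = ℕP.≤-trans (go a≤b) (C-suc _ j)

lam-bounds : ∀ m n k (y : Vec (Fin m) n) → (+ 0 ℤ.≤ lam m n k y) × (lam m n k y ℤ.≤ lamBound m n k)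
lam-bounds m n k y with ℕP.≤-<-connex k n
... | inj₁ k≤n rewrite lam-≤ y k≤n | lamBound-≤ {m} k≤n =
  ℤ.+≤+ ℕ.z≤n ,
  ℤ.+≤+ (ℕP.*-monoʳ-≤ (m ^ (n ∸ k)) (ℕP.≤-trans (C-monoˡ-≤ (n ∸ k) (zeroCount≤length y))
                                                (ℕP.≤-reflexive (sym (nCk≡nC[n∸k] k≤n)))))
... | inj₂ n<k rewrite lam-> y n<k | lamBound-> {m} n<k = ℤ.+≤+ ℕ.z≤n , ℤ.+≤+ ℕ.z≤n

-- The eigenbasis

module Spectrum (m′ : ℕ) where

  m : ℕ
  m = suc m′

  V : ℕ → Set
  V n = Vec (Fin m) n

  δ : Fin m → Fin m → ℤ
  δ = diagonal FinP._≟_ (λ _ → + 1)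

  δ-≡ : ∀ a → δ a a ≡ + 1
  δ-≡ = diagonal-≡ FinP._≟_ (λ _ → + 1)

  δ-≢ : ∀ {a b} → a ≢ b → δ a b ≡ + 0
  δ-≢ = diagonal-≢ FinP._≟_ (λ _ → + 1)

  sumL-δ : (g : Fin m → ℤ) (a : Fin m) → sumL (allFin m) (λ x → g x * δ x a) ≡ g a
  sumL-δ g a = trans (sumL-diagonalʳ (FinP._≟_ {m}) (λ _ → + 1) g (UniqueP.allFin⁺ m) (MemP.∈-allFin a))
                     (ℤP.*-identityʳ (g a))

  χ : Fin m → Fin m → ℤ
  χ Fin.zero    x = + 1
  χ (Fin.suc j) x = δ x Fin.zero - δ x (Fin.suc j)

  sumL-χ-zero : sumL (allFin m) (χ Fin.zero) ≡ + m
  sumL-χ-zero = trans (sumL-ones (allFin m)) (cong +_ (ListP.length-tabulate (λ x → x)))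
    where
    sumL-ones : (xs : List (Fin m)) → sumL xs (λ _ → + 1) ≡ + List.length xs
    sumL-ones []       = refl
    sumL-ones (x ∷ xs) = cong (_+_ (+ 1)) (sumL-ones xs)

  sumL-χ-suc : ∀ j → sumL (allFin m) (χ (Fin.suc j)) ≡ + 0
  sumL-χ-suc j = begin
    sumL (allFin m) (λ x → δ x Fin.zero + - δ x (Fin.suc j))
      ≡⟨ sumL-+ (allFin m) (λ x → δ x Fin.zero) (λ x → - δ x (Fin.suc j)) ⟩
    sumL (allFin m) (λ x → δ x Fin.zero) + sumL (allFin m) (λ x → - δ x (Fin.suc j))
      ≡⟨ cong₂ _+_ (sumL-δ-one Fin.zero) (trans (sumL-neg (allFin m) (λ x → δ x (Fin.suc j))) (cong -_ (sumL-δ-one (Fin.suc j)))) ⟩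
    + 1 - + 1 ∎
    where
    sumL-δ-one : ∀ a → sumL (allFin m) (λ x → δ x a) ≡ + 1
    sumL-δ-one a = trans (sumL-cong (allFin m) (λ x → sym (ℤP.*-identityˡ (δ x a)))) (sumL-δ (λ _ → + 1) a)

  χ-at-zero : ∀ y → χ y Fin.zero ≡ + 1
  χ-at-zero Fin.zero    = refl
  χ-at-zero (Fin.suc j) = cong₂ _-_ (δ-≡ Fin.zero) (δ-≢ {Fin.zero} {Fin.suc j} λ ())

  eigvec : ∀ {n} → V n → V n → ℤ
  eigvec []       []       = + 1
  eigvec (y ∷ ys) (x ∷ xs) = χ y x * eigvec ys xs

  eigvec-at-zero : ∀ {n} (y : V n) → eigvec y (Vec.replicate n Fin.zero) ≡ + 1
  eigvec-at-zero []       = refl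
  eigvec-at-zero (y ∷ ys) = cong₂ _*_ (χ-at-zero y) (eigvec-at-zero ys)

  step : Fin m → ℤ → ℤ → ℤ
  step Fin.zero    μ μ′ = + m * μ + (μ′ - μ)
  step (Fin.suc _) μ μ′ = μ′ - μ

  step-+ : ∀ y₀ μ μ′ ν ν′ → step y₀ (μ + ν) (μ′ + ν′) ≡ step y₀ μ μ′ + step y₀ ν ν′
  step-+ Fin.zero    μ μ′ ν ν′ = distribute (+ m) μ μ′ ν ν′
    where
    distribute : ∀ M μ μ′ ν ν′ → M * (μ + ν) + (μ′ + ν′ - (μ + ν)) ≡ M * μ + (μ′ - μ) + (M * ν + (ν′ - ν))
    distribute = solve-∀
  step-+ (Fin.suc _) μ μ′ ν ν′ = distribute μ μ′ ν ν′
    where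
    distribute : ∀ μ μ′ ν ν′ → μ′ + ν′ - (μ + ν) ≡ μ′ - μ + (ν′ - ν)
    distribute = solve-∀

  eigenvalue : ∀ {n} → (ℕ → ℤ) → V n → ℤ
  eigenvalue F []        = F 0
  eigenvalue F (y₀ ∷ ys) = step y₀ (eigenvalue F ys) (eigenvalue (λ z → F (suc z)) ys)

  eigenvalue-cong : ∀ {n} {F G : ℕ → ℤ} → (∀ z → F z ≡ G z) → (y : V n) → eigenvalue F y ≡ eigenvalue G y
  eigenvalue-cong eq []       = eq 0
  eigenvalue-cong eq (y₀ ∷ y) = cong₂ (step y₀) (eigenvalue-cong eq y) (eigenvalue-cong (λ z → eq (suc z)) y)

  eigenvalue-+ : ∀ {n} (F G : ℕ → ℤ) (y : V n) → eigenvalue (λ z → F z + G z) y ≡ eigenvalue F y + eigenvalue G y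
  eigenvalue-+ F G []       = refl
  eigenvalue-+ F G (y₀ ∷ y) =
    trans (cong₂ (step y₀) (eigenvalue-+ F G y) (eigenvalue-+ (λ z → F (suc z)) (λ z → G (suc z)) y))
          (step-+ y₀ _ _ _ _)

  split-at : (S : Fin m → ℤ) (f₀ : Fin m) {a b : ℤ} → S f₀ ≡ b → (∀ x → x ≢ f₀ → S x ≡ a) →
             ∀ x → S x ≡ a + δ x f₀ * (b - a)
  split-at S f₀ {a} {b} at off x = by-cases (x FinP.≟ f₀)
    where
    cancel : ∀ a b → a + + 1 * (b - a) ≡ b
    cancel = solve-∀
    by-cases : Dec (x ≡ f₀) → S x ≡ a + δ x f₀ * (b - a)
    by-cases (yes refl) = trans at (sym (trans (cong (λ d → a + d * (b - a)) (δ-≡ x)) (cancel a b)))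
    by-cases (no x≢f₀)  = trans (off x x≢f₀) (sym (trans (cong (λ d → a + d * (b - a)) (δ-≢ x≢f₀)) (ℤP.+-identityʳ a)))


  sumL-χ-split : ∀ y₀ f₀ μ μ′ e →
                 sumL (allFin m) (λ x → χ y₀ x * (μ * e + δ x f₀ * (μ′ * e - μ * e))) ≡ step y₀ μ μ′ * (χ y₀ f₀ * e)
  sumL-χ-split y₀ f₀ μ μ′ e = begin
    sumL (allFin m) (λ x → χ y₀ x * (μ * e + δ x f₀ * (μ′ * e - μ * e)))
      ≡⟨ sumL-linear (allFin m) (μ * e) (+ 1) (λ x → spread (χ y₀ x) (μ * e) (δ x f₀) (μ′ * e - μ * e)) ⟩
    μ * e * sumL (allFin m) (χ y₀) + + 1 * sumL (allFin m) (λ x → χ y₀ x * (μ′ * e - μ * e) * δ x f₀)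
      ≡⟨ cong (λ z → μ * e * sumL (allFin m) (χ y₀) + + 1 * z) (sumL-δ (λ x → χ y₀ x * (μ′ * e - μ * e)) f₀) ⟩
    μ * e * sumL (allFin m) (χ y₀) + + 1 * (χ y₀ f₀ * (μ′ * e - μ * e))
      ≡⟨ collect y₀ ⟩
    step y₀ μ μ′ * (χ y₀ f₀ * e) ∎
    where
    spread : ∀ c a d b → c * (a + d * b) ≡ a * c + + 1 * (c * b * d)
    spread = solve-∀
    collect : ∀ y₀ → μ * e * sumL (allFin m) (χ y₀) + + 1 * (χ y₀ f₀ * (μ′ * e - μ * e))
                       ≡ step y₀ μ μ′ * (χ y₀ f₀ * e)
    collect Fin.zero    = trans (cong (λ σ → μ * e * σ + + 1 * (+ 1 * (μ′ * e - μ * e))) sumL-χ-zero) (identity (+ m) μ μ′ e)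
      where
      identity : ∀ M μ μ′ e → μ * e * M + + 1 * (+ 1 * (μ′ * e - μ * e)) ≡ (M * μ + (μ′ - μ)) * (+ 1 * e)
      identity = solve-∀
    collect (Fin.suc j) = trans (cong (λ σ → μ * e * σ + + 1 * (χ (Fin.suc j) f₀ * (μ′ * e - μ * e))) (sumL-χ-suc j))
                                (identity (χ (Fin.suc j) f₀) μ μ′ e)
      where
      identity : ∀ c μ μ′ e → μ * e * + 0 + + 1 * (c * (μ′ * e - μ * e)) ≡ (μ′ - μ) * (c * e)
      identity = solve-∀

  eigvec-eigen : ∀ n (F : ℕ → ℤ) (f y : V n) →
                 sumL (allVecs m n) (λ g → F (zeroCount (vsub g f)) * eigvec y g) ≡ eigenvalue F y * eigvec y f
  eigvec-eigen zero    F [] [] = ℤP.+-identityʳ _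
  eigvec-eigen (suc n) F (f₀ ∷ f) (y₀ ∷ y) = begin
    sumL (allVecs m (suc n)) (λ g → F (zeroCount (vsub g (f₀ ∷ f))) * eigvec (y₀ ∷ y) g)
      ≡⟨ sumL-allVecs-suc m n _ ⟩
    sumL (allFin m) (λ x → sumL (allVecs m n) (λ g → F (zeroCount (subMod x f₀ ∷ vsub g f)) * (χ y₀ x * eigvec y g)))
      ≡⟨ sumL-cong (allFin m) (λ x → trans (sumL-cong (allVecs m n) (λ g → swap-factors (entry x g) (χ y₀ x) (eigvec y g)))
                                           (sumL-*ˡ (allVecs m n) (χ y₀ x) (summand x))) ⟩
    sumL (allFin m) (λ x → χ y₀ x * S x)
      ≡⟨ sumL-cong (allFin m) (λ x → cong (χ y₀ x *_) (split-at S f₀ S-at-f₀ S-off-f₀ x)) ⟩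
    sumL (allFin m) (λ x → χ y₀ x * (μ * e + δ x f₀ * (μ′ * e - μ * e)))
      ≡⟨ sumL-χ-split y₀ f₀ μ μ′ e ⟩
    eigenvalue F (y₀ ∷ y) * (χ y₀ f₀ * e) ∎
    where
    e μ μ′ : ℤ
    e  = eigvec y f
    μ  = eigenvalue F y
    μ′ = eigenvalue (λ z → F (suc z)) y
    entry summand : Fin m → V n → ℤ
    entry x g = F (zeroCount (subMod x f₀ ∷ vsub g f))
    summand x g = entry x g * eigvec y g
    S : Fin m → ℤ
    S x = sumL (allVecs m n) (summand x)
    S-at-f₀ : S f₀ ≡ μ′ * e
    S-at-f₀ = trans (sumL-cong (allVecs m n) (λ g → cong (λ z → F z * eigvec y g) (zeroCount-∷-zero _ _ (subMod-self f₀))))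
                    (eigvec-eigen n (λ z → F (suc z)) f y)
    S-off-f₀ : ∀ x → x ≢ f₀ → S x ≡ μ * e
    S-off-f₀ x x≢f₀ = trans (sumL-cong (allVecs m n) (λ g → cong (λ z → F z * eigvec y g)
                                         (zeroCount-∷-nonzero _ _ (x≢f₀ ∘′ subMod≡0⇒≡ x f₀))))
                            (eigvec-eigen n F f y)
    swap-factors : ∀ p c q → p * (c * q) ≡ c * (p * q)
    swap-factors = solve-∀

  binomial : ℕ → ℕ → ℤ
  binomial k z = + (z C k)

  pascal-scaled : ∀ d z → m ℕ.* (m ^ d ℕ.* (z C d)) ℕ.+ m ^ suc d ℕ.* (z C suc d) ≡ m ^ suc d ℕ.* (suc z C suc d)
  pascal-scaled d z = begin
    m ℕ.* (m ^ d ℕ.* (z C d)) ℕ.+ m ^ suc d ℕ.* (z C suc d)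
      ≡⟨ cong (ℕ._+ m ^ suc d ℕ.* (z C suc d)) (sym (ℕP.*-assoc m (m ^ d) (z C d))) ⟩
    m ^ suc d ℕ.* (z C d) ℕ.+ m ^ suc d ℕ.* (z C suc d)
      ≡⟨ sym (ℕP.*-distribˡ-+ (m ^ suc d) (z C d) (z C suc d)) ⟩
    m ^ suc d ℕ.* (z C d ℕ.+ z C suc d)
      ≡⟨ cong (m ^ suc d ℕ.*_) (nCk+nC[k+1]≡[n+1]C[k+1] z d) ⟩
    m ^ suc d ℕ.* (suc z C suc d) ∎

  lam-∷-nonzero : ∀ {n} k j (y : V n) → lam m (suc n) (suc k) (Fin.suc j ∷ y) ≡ lam m n k y
  lam-∷-nonzero {n} k j y with ℕP.≤-<-connex k n
  ... | inj₁ k≤n = trans (lam-≤ (Fin.suc j ∷ y) (ℕ.s≤s k≤n)) (sym (lam-≤ y k≤n))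
  ... | inj₂ n<k = trans (lam-> (Fin.suc j ∷ y) (ℕ.s≤s n<k)) (sym (lam-> y n<k))

  lam-zero-∷-nonzero : ∀ {n} j (y : V n) → lam m (suc n) 0 (Fin.suc j ∷ y) ≡ + 0
  lam-zero-∷-nonzero {n} j y = begin
    lam m (suc n) 0 (Fin.suc j ∷ y)            ≡⟨ lam-≤ (Fin.suc j ∷ y) ℕ.z≤n ⟩
    + (m ^ suc n ℕ.* (zeroCount y C suc n))    ≡⟨ cong (λ c → + (m ^ suc n ℕ.* c)) (k>n⇒nCk≡0 (ℕ.s≤s (zeroCount≤length y))) ⟩
    + (m ^ suc n ℕ.* 0)                        ≡⟨ cong +_ (ℕP.*-zeroʳ (m ^ suc n)) ⟩
    + 0                                        ∎

  lam-zero-∷-zero : ∀ {n} (y : V n) → lam m (suc n) 0 (Fin.zero ∷ y) ≡ + m * lam m n 0 y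
  lam-zero-∷-zero {n} y = begin
    lam m (suc n) 0 (Fin.zero ∷ y)                   ≡⟨ lam-≤ (Fin.zero ∷ y) ℕ.z≤n ⟩
    + (m ^ suc n ℕ.* (suc z C suc n))                ≡⟨ cong +_ (sym (pascal-scaled n z)) ⟩
    + (m ℕ.* X ℕ.+ m ^ suc n ℕ.* (z C suc n))
      ≡⟨ cong (λ c → + (m ℕ.* X ℕ.+ m ^ suc n ℕ.* c)) (k>n⇒nCk≡0 (ℕ.s≤s (zeroCount≤length y))) ⟩
    + (m ℕ.* X ℕ.+ m ^ suc n ℕ.* 0)                  ≡⟨ cong (λ c → + (m ℕ.* X ℕ.+ c)) (ℕP.*-zeroʳ (m ^ suc n)) ⟩
    + (m ℕ.* X ℕ.+ 0)                                ≡⟨ cong +_ (ℕP.+-identityʳ (m ℕ.* X)) ⟩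
    + (m ℕ.* X)                                      ≡⟨ ℤP.pos-* m X ⟩
    + m * + X                                        ≡⟨ cong (+ m *_) (sym (lam-≤ y ℕ.z≤n)) ⟩
    + m * lam m n 0 y                                ∎
    where
    z X : ℕ
    z = zeroCount y
    X = m ^ n ℕ.* (z C n)

  lam-suc-∷-zero : ∀ {n} k (y : V n) → lam m (suc n) (suc k) (Fin.zero ∷ y) ≡ + m * lam m n (suc k) y + lam m n k y
  lam-suc-∷-zero {n} k y with ℕP.<-cmp k n
  ... | tri< k<n _ _ = begin
    lam m (suc n) (suc k) (Fin.zero ∷ y)                       ≡⟨ lam-≤ (Fin.zero ∷ y) (ℕ.s≤s (ℕP.<⇒≤ k<n)) ⟩
    + (m ^ (n ∸ k) ℕ.* (suc z C (n ∸ k)))                      ≡⟨ cong (λ e → + (m ^ e ℕ.* (suc z C e))) n∸k≡1+d ⟩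
    + (m ^ suc d ℕ.* (suc z C suc d))                          ≡⟨ cong +_ (sym (pascal-scaled d z)) ⟩
    + (m ℕ.* (m ^ d ℕ.* (z C d)) ℕ.+ m ^ suc d ℕ.* (z C suc d))
      ≡⟨ ℤP.pos-+ (m ℕ.* (m ^ d ℕ.* (z C d))) (m ^ suc d ℕ.* (z C suc d)) ⟩
    + (m ℕ.* (m ^ d ℕ.* (z C d))) + + (m ^ suc d ℕ.* (z C suc d))
      ≡⟨ cong₂ _+_ (ℤP.pos-* m _) (cong (λ e → + (m ^ e ℕ.* (z C e))) (sym n∸k≡1+d)) ⟩
    + m * + (m ^ d ℕ.* (z C d)) + + (m ^ (n ∸ k) ℕ.* (z C (n ∸ k)))
      ≡⟨ cong₂ (λ p q → + m * p + q) (sym (lam-≤ y k<n)) (sym (lam-≤ y (ℕP.<⇒≤ k<n))) ⟩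
    + m * lam m n (suc k) y + lam m n k y                      ∎
    where
    z d : ℕ
    z = zeroCount y
    d = n ∸ suc k
    n∸k≡1+d : n ∸ k ≡ suc d
    n∸k≡1+d = ℕP.+-∸-assoc 1 k<n
  ... | tri≈ _ refl _ = begin
    lam m (suc n) (suc n) (Fin.zero ∷ y)                       ≡⟨ lam-≤ (Fin.zero ∷ y) ℕP.≤-refl ⟩
    + (m ^ (n ∸ n) ℕ.* (suc z C (n ∸ n)))                      ≡⟨ cong (λ e → + (m ^ e ℕ.* (suc z C e))) (ℕP.n∸n≡0 n) ⟩
    + 1                                                        ≡⟨ cong (λ e → + (m ^ e ℕ.* (z C e))) (sym (ℕP.n∸n≡0 n)) ⟩
    + (m ^ (n ∸ n) ℕ.* (z C (n ∸ n)))                          ≡⟨ sym (lam-≤ y ℕP.≤-refl) ⟩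
    lam m n n y                                                ≡⟨ sym (ℤP.+-identityˡ _) ⟩
    + 0 + lam m n n y                                          ≡⟨ cong (_+ lam m n n y) (sym (ℤP.*-zeroʳ (+ m))) ⟩
    + m * + 0 + lam m n n y                                    ≡⟨ cong (λ p → + m * p + lam m n n y) (sym (lam-> y ℕP.≤-refl)) ⟩
    + m * lam m n (suc n) y + lam m n n y                      ∎
    where
    z : ℕ
    z = zeroCount y
  ... | tri> _ _ n<k = begin
    lam m (suc n) (suc k) (Fin.zero ∷ y)                       ≡⟨ lam-> (Fin.zero ∷ y) (ℕ.s≤s n<k) ⟩
    + 0                                                        ≡⟨ cong (_+ + 0) (sym (ℤP.*-zeroʳ (+ m))) ⟩
    + m * + 0 + + 0
      ≡⟨ cong₂ (λ p q → + m * p + q) (sym (lam-> y (ℕP.m<n⇒m<1+n n<k))) (sym (lam-> y n<k)) ⟩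
    + m * lam m n (suc k) y + lam m n k y                      ∎


  lam-step-zero : ∀ {n} y₀ (y : V n) → step y₀ (lam m n 0 y) (lam m n 0 y) ≡ lam m (suc n) 0 (y₀ ∷ y)
  lam-step-zero Fin.zero    y = trans (cancel (+ m) (lam m _ 0 y)) (sym (lam-zero-∷-zero y))
    where
    cancel : ∀ M μ → M * μ + (μ - μ) ≡ M * μ
    cancel = solve-∀
  lam-step-zero (Fin.suc j) y = trans (ℤP.+-inverseʳ (lam m _ 0 y)) (sym (lam-zero-∷-nonzero j y))

  lam-step-suc : ∀ {n} k y₀ (y : V n) →
                 step y₀ (lam m n (suc k) y) (lam m n k y + lam m n (suc k) y) ≡ lam m (suc n) (suc k) (y₀ ∷ y)
  lam-step-suc k Fin.zero    y = trans (cancel (+ m) (lam m _ k y) (lam m _ (suc k) y)) (sym (lam-suc-∷-zero k y))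
    where
    cancel : ∀ M μ μ′ → M * μ′ + (μ + μ′ - μ′) ≡ M * μ′ + μ
    cancel = solve-∀
  lam-step-suc k (Fin.suc j) y = trans (cancel (lam m _ k y) (lam m _ (suc k) y)) (sym (lam-∷-nonzero k j y))
    where
    cancel : ∀ μ μ′ → μ + μ′ - μ′ ≡ μ
    cancel = solve-∀

  eigenvalue-binomial : ∀ {n} k (y : V n) → eigenvalue (binomial k) y ≡ lam m n k y
  eigenvalue-pascal : ∀ {n} k (y : V n) → eigenvalue (λ z → binomial (suc k) (suc z)) y ≡ lam m n k y + lam m n (suc k) y
  eigenvalue-binomial zero    []       = refl
  eigenvalue-binomial (suc k) []       = refl
  eigenvalue-binomial zero    (y₀ ∷ y) =
    trans (cong (λ μ → step y₀ μ μ) (eigenvalue-binomial 0 y)) (lam-step-zero y₀ y)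
  eigenvalue-binomial (suc k) (y₀ ∷ y) =
    trans (cong₂ (step y₀) (eigenvalue-binomial (suc k) y) (eigenvalue-pascal k y)) (lam-step-suc k y₀ y)

  eigenvalue-pascal k y = begin
    eigenvalue (λ z → binomial (suc k) (suc z)) y
      ≡⟨ eigenvalue-cong (λ z → cong +_ (sym (nCk+nC[k+1]≡[n+1]C[k+1] z k))) y ⟩
    eigenvalue (λ z → binomial k z + binomial (suc k) z) y
      ≡⟨ eigenvalue-+ (binomial k) (binomial (suc k)) y ⟩
    eigenvalue (binomial k) y + eigenvalue (binomial (suc k)) y
      ≡⟨ cong₂ _+_ (eigenvalue-binomial k y) (eigenvalue-binomial (suc k) y) ⟩
    lam m _ k y + lam m _ (suc k) y ∎

  ψ : Fin m → Fin m → ℤ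
  ψ Fin.zero    s = + 1
  ψ (Fin.suc j) s = + 1 - + m * δ s (Fin.suc j)

  sumL-ψ-suc : ∀ a (g : Fin m → ℤ) → sumL (allFin m) (λ s → ψ (Fin.suc a) s * g s) ≡ sumL (allFin m) g - + m * g (Fin.suc a)
  sumL-ψ-suc a g = begin
    sumL (allFin m) (λ s → ψ (Fin.suc a) s * g s)
      ≡⟨ sumL-linear (allFin m) {g = g} {h = λ s → g s * δ s (Fin.suc a)} (+ 1) (- + m) (λ s → distrib (+ m) (δ s (Fin.suc a)) (g s)) ⟩
    + 1 * sumL (allFin m) g + - + m * sumL (allFin m) (λ s → g s * δ s (Fin.suc a))
      ≡⟨ cong (λ z → + 1 * sumL (allFin m) g + - + m * z) (sumL-δ g (Fin.suc a)) ⟩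
    + 1 * sumL (allFin m) g + - + m * g (Fin.suc a)
      ≡⟨ tidy (sumL (allFin m) g) (+ m) (g (Fin.suc a)) ⟩
    sumL (allFin m) g - + m * g (Fin.suc a) ∎
    where
    distrib : ∀ M d x → (+ 1 - M * d) * x ≡ + 1 * x + - M * (x * d)
    distrib = solve-∀
    tidy : ∀ σ M x → + 1 * σ + - M * x ≡ σ - M * x
    tidy = solve-∀

  sumL-ψχ : ∀ i j → sumL (allFin m) (λ s → ψ i s * χ j s) ≡ + m * δ i j
  sumL-ψχ Fin.zero    Fin.zero    = trans sumL-χ-zero
    (sym (trans (cong (+ m *_) (δ-≡ Fin.zero)) (ℤP.*-identityʳ (+ m))))
  sumL-ψχ Fin.zero    (Fin.suc b) = trans (trans (sumL-cong (allFin m) (λ s → ℤP.*-identityˡ (χ (Fin.suc b) s))) (sumL-χ-suc b))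
    (sym (trans (cong (+ m *_) (δ-≢ {Fin.zero} {Fin.suc b} λ ())) (ℤP.*-zeroʳ (+ m))))
  sumL-ψχ (Fin.suc a) Fin.zero    = begin
    sumL (allFin m) (λ s → ψ (Fin.suc a) s * χ Fin.zero s) ≡⟨ sumL-ψ-suc a (χ Fin.zero) ⟩
    sumL (allFin m) (χ Fin.zero) - + m * + 1               ≡⟨ cong (_- + m * + 1) sumL-χ-zero ⟩
    + m - + m * + 1                                        ≡⟨ cancel (+ m) ⟩
    + m * + 0                                              ≡⟨ cong (+ m *_) (sym (δ-≢ {Fin.suc a} {Fin.zero} λ ())) ⟩
    + m * δ (Fin.suc a) Fin.zero                           ∎
    where
    cancel : ∀ M → M - M * + 1 ≡ M * + 0
    cancel = solve-∀
  sumL-ψχ (Fin.suc a) (Fin.suc b) = begin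
    sumL (allFin m) (λ s → ψ (Fin.suc a) s * χ (Fin.suc b) s)
      ≡⟨ sumL-ψ-suc a (χ (Fin.suc b)) ⟩
    sumL (allFin m) (χ (Fin.suc b)) - + m * (δ (Fin.suc a) Fin.zero - δ (Fin.suc a) (Fin.suc b))
      ≡⟨ cong₂ (λ σ d → σ - + m * (d - δ (Fin.suc a) (Fin.suc b))) (sumL-χ-suc b) (δ-≢ {Fin.suc a} {Fin.zero} λ ()) ⟩
    + 0 - + m * (+ 0 - δ (Fin.suc a) (Fin.suc b))
      ≡⟨ cancel (+ m) (δ (Fin.suc a) (Fin.suc b)) ⟩
    + m * δ (Fin.suc a) (Fin.suc b) ∎
    where
    cancel : ∀ M d → + 0 - M * (+ 0 - d) ≡ M * d
    cancel = solve-∀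

  dualvec : ∀ {n} → V n → V n → ℤ
  dualvec []       []       = + 1
  dualvec (y ∷ ys) (s ∷ ss) = ψ y s * dualvec ys ss

  _≟V_ : ∀ {n} → DecidableEquality (V n)
  _≟V_ = VecP.≡-dec FinP._≟_

  δV : ∀ {n} → V n → V n → ℤ
  δV = diagonal _≟V_ (λ _ → + 1)

  δV-≡ : ∀ {n} (a : V n) → δV a a ≡ + 1
  δV-≡ = diagonal-≡ _≟V_ (λ _ → + 1)

  δV-≢ : ∀ {n} {a b : V n} → a ≢ b → δV a b ≡ + 0
  δV-≢ = diagonal-≢ _≟V_ (λ _ → + 1)

  δ-∷ : ∀ {n} x x′ (xs xs′ : V n) → δ x x′ * δV xs xs′ ≡ δV (x ∷ xs) (x′ ∷ xs′)
  δ-∷ x x′ xs xs′ = by-cases (x FinP.≟ x′) (xs ≟V xs′)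
    where
    by-cases : Dec (x ≡ x′) → Dec (xs ≡ xs′) → δ x x′ * δV xs xs′ ≡ δV (x ∷ xs) (x′ ∷ xs′)
    by-cases (yes refl) (yes refl) =
      trans (cong₂ _*_ (δ-≡ x) (δV-≡ xs)) (sym (δV-≡ (x ∷ xs)))
    by-cases (no x≢x′) _ =
      trans (cong (_* δV xs xs′) (δ-≢ x≢x′)) (sym (δV-≢ {a = x ∷ xs} {b = x′ ∷ xs′} (x≢x′ ∘′ VecP.∷-injectiveˡ)))
    by-cases (yes _) (no xs≢xs′) =
      trans (trans (cong (δ x x′ *_) (δV-≢ xs≢xs′)) (ℤP.*-zeroʳ (δ x x′)))
            (sym (δV-≢ {a = x ∷ xs} {b = x′ ∷ xs′} (xs≢xs′ ∘′ VecP.∷-injectiveʳ)))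

  sumL-dualvec-eigvec : ∀ n (y y′ : V n) → sumL (allVecs m n) (λ s → dualvec y s * eigvec y′ s) ≡ + (m ^ n) * δV y y′
  sumL-dualvec-eigvec zero    []       []        = sym (cong (+ 1 *_) (δV-≡ []))
  sumL-dualvec-eigvec (suc n) (y₀ ∷ y) (y₀′ ∷ y′) = begin
    sumL (allVecs m (suc n)) (λ s → dualvec (y₀ ∷ y) s * eigvec (y₀′ ∷ y′) s)
      ≡⟨ sumL-allVecs-suc m n _ ⟩
    sumL (allFin m) (λ x → sumL (allVecs m n) (λ s → ψ y₀ x * dualvec y s * (χ y₀′ x * eigvec y′ s)))
      ≡⟨ sumL-cong (allFin m) (λ x → trans (sumL-cong (allVecs m n)
                                                      (λ s → regroup (ψ y₀ x) (dualvec y s) (χ y₀′ x) (eigvec y′ s)))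
                                           (sumL-*ˡ (allVecs m n) (ψ y₀ x * χ y₀′ x) _)) ⟩
    sumL (allFin m) (λ x → ψ y₀ x * χ y₀′ x * sumL (allVecs m n) (λ s → dualvec y s * eigvec y′ s))
      ≡⟨ sumL-*ʳ (allFin m) _ (λ x → ψ y₀ x * χ y₀′ x) ⟩
    sumL (allFin m) (λ x → ψ y₀ x * χ y₀′ x) * sumL (allVecs m n) (λ s → dualvec y s * eigvec y′ s)
      ≡⟨ cong₂ _*_ (sumL-ψχ y₀ y₀′) (sumL-dualvec-eigvec n y y′) ⟩
    + m * δ y₀ y₀′ * (+ (m ^ n) * δV y y′)
      ≡⟨ regroup (+ m) (δ y₀ y₀′) (+ (m ^ n)) (δV y y′) ⟩
    + m * + (m ^ n) * (δ y₀ y₀′ * δV y y′)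
      ≡⟨ cong₂ _*_ (sym (ℤP.pos-* m (m ^ n))) (δ-∷ y₀ y₀′ y y′) ⟩
    + (m ^ suc n) * δV (y₀ ∷ y) (y₀′ ∷ y′) ∎
    where
    regroup : ∀ a b c d → a * b * (c * d) ≡ a * c * (b * d)
    regroup = solve-∀

  module Eigenbasis (n k : ℕ) where

    Lv : List (V n)
    Lv = allVecs m n

    P : V n → V n → ℤ
    P s y = eigvec y s

    Λ : ℤ → V n → V n → ℤ
    Λ t = diagonal _≟V_ (λ y → t - lam m n k y)

    A-eigvec : ∀ y f → sumL Lv (λ g → Abin m n k f g * eigvec y g) ≡ lam m n k y * eigvec y f
    A-eigvec y f = trans (eigvec-eigen n (binomial k) f y) (cong (_* eigvec y f) (eigenvalue-binomial k y))

    det-P≢0 : det (map P Lv) Lv ≢ + 0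
    det-P≢0 det≡0 = prodL-≢0 Lv (λ _ → mⁿ≢0) (begin
      prodL Lv (λ _ → + (m ^ n) * + 1)                  ≡⟨ sym (det-diagonal _≟V_ _ Lv (allVecs-unique m n)) ⟩
      det (map (diagonal _≟V_ (λ _ → + (m ^ n) * + 1)) Lv) Lv
        ≡⟨ sym (det-map-cong (λ r c → trans (sumL-dualvec-eigvec n r c) (*-diagonal _≟V_ (+ (m ^ n)) _ r c)) Lv Lv) ⟩
      det (map (matMul dualvec P Lv) Lv) Lv             ≡⟨ det-mul dualvec P Lv Lv ⟩
      detL dualvec Lv Lv * det (map P Lv) Lv            ≡⟨ cong (detL dualvec Lv Lv *_) det≡0 ⟩
      detL dualvec Lv Lv * + 0                          ≡⟨ ℤP.*-zeroʳ (detL dualvec Lv Lv) ⟩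
      + 0                                               ∎)
      where
      mⁿ≢0 : + (m ^ n) * + 1 ≢ + 0
      mⁿ≢0 eq = ℕ.≢-nonZero⁻¹ (m ^ n) {{ℕP.m^n≢0 m n}} (ℤP.+-injective (trans (sym (ℤP.*-identityʳ _)) eq))

    charMat≡diagonal-A : ∀ t r s → charMat m n k t r s ≡ diagonal _≟V_ (λ _ → t) r s - Abin m n k r s
    charMat≡diagonal-A t r s with VecP.≡-dec FinP._≟_ r s
    ... | yes _ = refl
    ... | no _  = sym (ℤP.+-identityˡ _)

    charMat-P : ∀ t r c → matMul (charMat m n k t) P Lv r c ≡ (t - lam m n k c) * eigvec c r
    charMat-P t r c = begin
      sumL Lv (λ s → charMat m n k t r s * eigvec c s)
        ≡⟨ sumL-linear Lv (+ 1) (- + 1) (λ s → trans (cong (_* eigvec c s) (charMat≡diagonal-A t r s))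
                                                     (distrib (tI r s) (Abin m n k r s) (eigvec c s))) ⟩
      + 1 * sumL Lv (λ s → tI r s * eigvec c s) + - + 1 * sumL Lv (λ s → Abin m n k r s * eigvec c s)
        ≡⟨ cong₂ (λ p q → + 1 * p + - + 1 * q)
                 (sumL-diagonalˡ _≟V_ _ (eigvec c) (allVecs-unique m n) (∈-allVecs m r)) (A-eigvec c r) ⟩
      + 1 * (t * eigvec c r) + - + 1 * (lam m n k c * eigvec c r)
        ≡⟨ collect t (lam m n k c) (eigvec c r) ⟩
      (t - lam m n k c) * eigvec c r ∎
      where
      tI : V n → V n → ℤ
      tI = diagonal _≟V_ (λ _ → t)
      distrib : ∀ d a e → (d - a) * e ≡ + 1 * (d * e) + - + 1 * (a * e)
      distrib = solve-∀
      collect : ∀ t l e → + 1 * (t * e) + - + 1 * (l * e) ≡ (t - l) * e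
      collect = solve-∀

    P-Λ : ∀ t r c → matMul P (Λ t) Lv r c ≡ (t - lam m n k c) * eigvec c r
    P-Λ t r c = trans (sumL-diagonalʳ _≟V_ _ (λ s → eigvec s r) (allVecs-unique m n) (∈-allVecs m c))
                      (ℤP.*-comm (eigvec c r) (t - lam m n k c))

    charPoly-factors : ∀ t → charPoly m n k t ≡ prodL Lv (λ y → t - lam m n k y)
    charPoly-factors t = ℤP.*-cancelʳ-≡ _ _ (det (map P Lv) Lv) {{ℤ.≢-nonZero det-P≢0}} (begin
      charPoly m n k t * det (map P Lv) Lv          ≡⟨ sym (det-mul (charMat m n k t) P Lv Lv) ⟩
      det (map (matMul (charMat m n k t) P Lv) Lv) Lv
        ≡⟨ det-map-cong (λ r c → trans (charMat-P t r c) (sym (P-Λ t r c))) Lv Lv ⟩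
      det (map (matMul P (Λ t) Lv) Lv) Lv           ≡⟨ det-mul P (Λ t) Lv Lv ⟩
      detL P Lv Lv * det (map (Λ t) Lv) Lv          ≡⟨ cong₂ _*_ (detL≡det P Lv Lv) (det-diagonal _≟V_ _ Lv (allVecs-unique m n)) ⟩
      det (map P Lv) Lv * prodL Lv (λ y → t - lam m n k y) ≡⟨ ℤP.*-comm (det (map P Lv) Lv) _ ⟩
      prodL Lv (λ y → t - lam m n k y) * det (map P Lv) Lv ∎)

theorem4p5 : (m n k : ℕ) .{{_ : NonZero m}} → 1 ≤ n →
    -- (1) each λ_y is an eigenvalue of A (nonzero eigenvector, integral since A and λ_y are)
    ((y : Vec (Fin m) n) →
      ∃ λ (v : Vec (Fin m) n → ℤ) → (∃ λ x → v x ≢ + 0) ×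
        ((f : Vec (Fin m) n) → sumL (allVecs m n) (λ g → Abin m n k f g * v g) ≡ lam m n k y * v f))
    -- (2) eigenvalues with (algebraic) multiplicity: det(tI - A) = ∏_y (t - λ_y)
    × ((t : ℤ) → charPoly m n k t ≡ prodL (allVecs m n) (λ y → t - lam m n k y))
    -- (3)+(4) λ_y is an integer (it is of type ℤ) with 0 ≤ λ_y ≤ m^(n-k) binom(n,k)
    × ((y : Vec (Fin m) n) → (+ 0 ≤ℤ lam m n k y) × (lam m n k y ≤ℤ lamBound m n k))
theorem4p5 (ℕ.suc m′) n k _ =
  (λ y → eigvec y , (Vec.replicate n Fin.zero , λ v₀≡0 → 1≢0 (trans (sym (eigvec-at-zero y)) v₀≡0)) , A-eigvec y) ,
  charPoly-factors ,
  lam-bounds (ℕ.suc m′) n k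
  where
  open Spectrum m′
  open Eigenbasis n k
  1≢0 : + 1 ≢ + 0
  1≢0 ()
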